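{- Let $\{P_n(x)\}_{n\ge 1}$ be the sequence defined in the context. For every $n\ge 1$, $P_n(x)$ is a polynomial in $x$ of degree $\lfloor\frac{n-1}{2}\rfloor$ with integer coefficients.
   Context: The sequence $\{P_n(x)\}_{n\ge1}$ of rational functions of $x$ is defined by $P_1=P_2=1$ and, for $n\ge 2$: if $n$ is odd, $4(2x+n)P_{n+1}(x)=2(x+n)P_n(x)+(2x+n)P_n(x+1)+(4x+n)\ell_n(x)$; if $n$ is even, $4P_{n+1}(x)=4(x+n)P_n(x)+2(2x+n+1)P_n(x+1)+(4x+n)\ell_{n-1}(x)$. Here for odd $r\ge1$, $\ell_r(x)=\prod_{j=1}^{(r-1)/2}(x+j)$ (the empty product equals $1$). -}

module Defs where

open import Data.Bool.Base using (Bool; true; false; if_then_else_; not)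
open import Data.Nat.Base as ℕ using (ℕ; zero; suc; ⌊_/2⌋; _∸_)
open import Data.Integer.Base as ℤ using (ℤ; +_)
open import Data.Rational.Base using (ℚ; 0ℚ; 1ℚ; _+_; _*_; _÷_; _/_; ≢-nonZero)
open import Data.Rational.Properties using (_≟_)
open import Data.List.Base using (List; []; _∷_)
open import Relation.Nullary using (yes; no)

ℕ→ℚ : ℕ → ℚ
ℕ→ℚ n = (+ n) / 1

ℤ→ℚ : ℤ → ℚ
ℤ→ℚ i = i / 1

-- total division on ℚ (value 0 when dividing by 0; never used at 0 for x ≥ 0)
divℚ : ℚ → ℚ → ℚ
divℚ p q with q ≟ 0ℚ
... | yes _ = 0ℚ
... | no q≢0 = _÷_ p q {{≢-nonZero q≢0}}

isOdd : ℕ → Bool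
isOdd zero = false
isOdd (suc n) = not (isOdd n)

prodShift : ℕ → ℚ → ℚ
prodShift zero x = 1ℚ
prodShift (suc k) x = prodShift k x * (x + ℕ→ℚ (suc k))

-- ℓ_r(x) = ∏_{j=1}^{(r-1)/2} (x + j)   (used only for odd r)
ℓ : ℕ → ℚ → ℚ
ℓ r = prodShift ⌊ r ∸ 1 /2⌋

step : ℕ → (ℚ → ℚ) → ℚ → ℚ
step n Pn x =
  if isOdd n
  then divℚ (ℕ→ℚ 2 * (x + ℕ→ℚ n) * Pn x
             + (ℕ→ℚ 2 * x + ℕ→ℚ n) * Pn (x + 1ℚ)
             + (ℕ→ℚ 4 * x + ℕ→ℚ n) * ℓ n x)
            (ℕ→ℚ 4 * (ℕ→ℚ 2 * x + ℕ→ℚ n))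
  else divℚ (ℕ→ℚ 4 * (x + ℕ→ℚ n) * Pn x
             + ℕ→ℚ 2 * (ℕ→ℚ 2 * x + ℕ→ℚ (suc n)) * Pn (x + 1ℚ)
             + (ℕ→ℚ 4 * x + ℕ→ℚ n) * ℓ (n ∸ 1) x)
            (ℕ→ℚ 4)

-- P n x ; P 0 is a junk value (the sequence starts at n = 1)
P : ℕ → ℚ → ℚ
P zero x = 1ℚ
P (suc zero) x = 1ℚ
P (suc (suc zero)) x = 1ℚ
P (suc (suc (suc m))) = step (suc (suc m)) (P (suc (suc m)))

evalPoly : List ℤ → ℚ → ℚ
evalPoly [] x = 0ℚ
evalPoly (c ∷ cs) x = ℤ→ℚ c + x * evalPoly cs x

-- The even and odd terms obey closed recursions that no longer divide:
--   P_{2k+4}(x) = (x + 2k + 3) P_{2k+2}(x + 1) + ℓ_{2k+3}(x),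
--   P_{2k+3}(x) = ℓ_{2k+3}(x) + (2x + 2k + 3) P_{2k+2}(x + 1),
-- with ℓ_{2k+3}(x) = (x + 1) ⋯ (x + k + 1). Taking them as definitions (Peven, Podd),
-- P_{2k+2} and P_{2k+3} are visibly integer polynomials of degrees k and k + 1 with
-- leading coefficients k + 1 and 2k + 3. They satisfy the defining recurrence because
-- of the invariant
--   (2y + 2k + 3) P_{2k+2}(y + 1) + (k + 1) ∏_{j ≤ k} (y + j) = 2 (y + 2k + 2) P_{2k+2}(y),
-- which passes from k to k + 1 and makes the division by 2x + n in the odd step exact.
-- Since P is computed with total division, agreement is proved for x ≥ 0, where 2x + n ≠ 0.

module Submission where

open import Algebra.Properties.Group using (∙-cancelʳ)
open import Data.Bool.Base using (true; false; not)
open import Data.Empty using (⊥-elim)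
open import Data.Integer.Base as ℤ using (ℤ; +[1+_]; 0ℤ; 1ℤ)
import Data.Integer.Properties as ℤ
open import Data.List.Base using (List; []; _∷_; _++_; length)
open import Data.Nat.Base as ℕ using (ℕ; zero; suc; _≥_; ⌊_/2⌋; _∸_)
import Data.Nat.Coprimality as Coprimality
import Data.Nat.Properties as ℕ
open import Data.Product using (Σ; ∃-syntax; _×_; _,_; proj₂)
open import Data.Rational.Base as ℚ using (ℚ; 0ℚ; 1ℚ; mkℚ; _+_; _*_; _/_; _≤_)
open import Data.Rational.Properties as ℚ using (_≟_; +-*-commutativeRing; +-0-group)
open import Data.Sum.Base using (_⊎_; inj₁; inj₂)
open import Data.Vec.Base using (Vec; []; _∷_; toList; zipWith; last; init; initLast)
open import Data.Vec.Properties using (toList-∷ʳ; length-toList)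
open import Function.Base using (_∋_)
open import Level using (0ℓ)
open import Relation.Binary.PropositionalEquality
open import Relation.Nullary.Decidable.Core using (yes; no; dec⇒maybe)
open import Tactic.RingSolver using (solve-∀; solve)
open import Tactic.RingSolver.Core.AlmostCommutativeRing using (AlmostCommutativeRing; fromCommutativeRing)

open import Defs

ℚ-ring : AlmostCommutativeRing 0ℓ 0ℓ
ℚ-ring = fromCommutativeRing +-*-commutativeRing (λ q → dec⇒maybe (0ℚ ≟ q))

cancel-multiple : ∀ {l r a b : ℚ} m → a ≡ b → l + m * b ≡ r + m * a → l ≡ r
cancel-multiple {l} {r} {a} m refl eq = ∙-cancelʳ +-0-group (m * a) l r eq

ℤ→ℚ≡mkℚ : ∀ i → ℤ→ℚ i ≡ mkℚ i 0 (Coprimality.sym (Coprimality.1-coprimeTo ℤ.∣ i ∣))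
ℤ→ℚ≡mkℚ i = ℚ.↥p/↧p≡p (mkℚ i 0 (Coprimality.sym (Coprimality.1-coprimeTo ℤ.∣ i ∣)))

ℤ→ℚ-+ : ∀ i j → ℤ→ℚ (i ℤ.+ j) ≡ ℤ→ℚ i + ℤ→ℚ j
ℤ→ℚ-+ i j = begin
  (i ℤ.+ j) / 1                 ≡⟨ cong₂ (λ a b → (a ℤ.+ b) / 1) (ℤ.*-identityʳ i) (ℤ.*-identityʳ j) ⟨
  (i ℤ.* 1ℤ ℤ.+ j ℤ.* 1ℤ) / 1   ≡⟨ cong₂ _+_ (ℤ→ℚ≡mkℚ i) (ℤ→ℚ≡mkℚ j) ⟨
  ℤ→ℚ i + ℤ→ℚ j                 ∎
  where open ≡-Reasoning

ℤ→ℚ-* : ∀ i j → ℤ→ℚ (i ℤ.* j) ≡ ℤ→ℚ i * ℤ→ℚ j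
ℤ→ℚ-* i j = sym (cong₂ _*_ (ℤ→ℚ≡mkℚ i) (ℤ→ℚ≡mkℚ j))

ℕ→ℚ-+ : ∀ m n → ℕ→ℚ (m ℕ.+ n) ≡ ℕ→ℚ m + ℕ→ℚ n
ℕ→ℚ-+ m n = ℤ→ℚ-+ (ℤ.+ m) (ℤ.+ n)

ℕ→ℚ-suc : ∀ n → ℕ→ℚ (suc n) ≡ ℕ→ℚ n + 1ℚ
ℕ→ℚ-suc n = trans (cong ℕ→ℚ (ℕ.+-comm 1 n)) (ℕ→ℚ-+ n 1)

ℕ→ℚ-double : ∀ n → ℕ→ℚ (n ℕ.* 2) ≡ ℕ→ℚ n + ℕ→ℚ n
ℕ→ℚ-double n = trans (cong ℕ→ℚ n*2≡n+n) (ℕ→ℚ-+ n n)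
  where
  n*2≡n+n : n ℕ.* 2 ≡ n ℕ.+ n
  n*2≡n+n = trans (ℕ.*-suc n 1) (cong (n ℕ.+_) (ℕ.*-identityʳ n))

evalVec : ∀ {n} → Vec ℤ n → ℚ → ℚ
evalVec cs = evalPoly (toList cs)

addHead : ∀ {n} → ℤ → Vec ℤ (suc n) → Vec ℤ (suc n)
addHead c (a ∷ as) = c ℤ.+ a ∷ as

mulLinear : ∀ {n} → ℤ → ℤ → Vec ℤ (suc n) → Vec ℤ (suc (suc n))
mulLinear a b (c ∷ [])          = b ℤ.* c ∷ a ℤ.* c ∷ []
mulLinear a b (c ∷ cs@(_ ∷ _)) = b ℤ.* c ∷ addHead (a ℤ.* c) (mulLinear a b cs)

shift : ∀ {n} → Vec ℤ (suc n) → Vec ℤ (suc n)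
shift (c ∷ [])          = c ∷ []
shift (c ∷ cs@(_ ∷ _)) = addHead c (mulLinear 1ℤ 1ℤ (shift cs))

evalVec-addHead : ∀ {n} c (cs : Vec ℤ (suc n)) x → evalVec (addHead c cs) x ≡ ℤ→ℚ c + evalVec cs x
evalVec-addHead c (a ∷ as) x =
  trans (cong (_+ x * evalVec as x) (ℤ→ℚ-+ c a)) (ℚ.+-assoc (ℤ→ℚ c) (ℤ→ℚ a) (x * evalVec as x))

evalVec-mulLinear : ∀ {n} a b (cs : Vec ℤ (suc n)) x →
  evalVec (mulLinear a b cs) x ≡ (ℤ→ℚ a * x + ℤ→ℚ b) * evalVec cs x
evalVec-mulLinear a b (c ∷ []) x = begin
  ℤ→ℚ (b ℤ.* c) + x * (ℤ→ℚ (a ℤ.* c) + x * 0ℚ)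
    ≡⟨ cong₂ (λ u v → u + x * (v + x * 0ℚ)) (ℤ→ℚ-* b c) (ℤ→ℚ-* a c) ⟩
  ℤ→ℚ b * ℤ→ℚ c + x * (ℤ→ℚ a * ℤ→ℚ c + x * 0ℚ)
    ≡⟨ distribute (ℤ→ℚ a) (ℤ→ℚ b) (ℤ→ℚ c) x ⟩
  (ℤ→ℚ a * x + ℤ→ℚ b) * (ℤ→ℚ c + x * 0ℚ)
    ∎
  where
  open ≡-Reasoning
  distribute : ∀ A B C x → B * C + x * (A * C + x * 0ℚ) ≡ (A * x + B) * (C + x * 0ℚ)
  distribute = solve-∀ ℚ-ring
evalVec-mulLinear a b (c ∷ cs@(_ ∷ _)) x = begin
  ℤ→ℚ (b ℤ.* c) + x * evalVec (addHead (a ℤ.* c) (mulLinear a b cs)) x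
    ≡⟨ cong (λ u → ℤ→ℚ (b ℤ.* c) + x * u) (evalVec-addHead (a ℤ.* c) (mulLinear a b cs) x) ⟩
  ℤ→ℚ (b ℤ.* c) + x * (ℤ→ℚ (a ℤ.* c) + evalVec (mulLinear a b cs) x)
    ≡⟨ cong₂ (λ u v → u + x * (v + evalVec (mulLinear a b cs) x)) (ℤ→ℚ-* b c) (ℤ→ℚ-* a c) ⟩
  ℤ→ℚ b * ℤ→ℚ c + x * (ℤ→ℚ a * ℤ→ℚ c + evalVec (mulLinear a b cs) x)
    ≡⟨ cong (λ u → ℤ→ℚ b * ℤ→ℚ c + x * (ℤ→ℚ a * ℤ→ℚ c + u)) (evalVec-mulLinear a b cs x) ⟩
  ℤ→ℚ b * ℤ→ℚ c + x * (ℤ→ℚ a * ℤ→ℚ c + (ℤ→ℚ a * x + ℤ→ℚ b) * evalVec cs x)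
    ≡⟨ distribute (ℤ→ℚ a) (ℤ→ℚ b) (ℤ→ℚ c) x (evalVec cs x) ⟩
  (ℤ→ℚ a * x + ℤ→ℚ b) * (ℤ→ℚ c + x * evalVec cs x)
    ∎
  where
  open ≡-Reasoning
  distribute : ∀ A B C x E → B * C + x * (A * C + (A * x + B) * E) ≡ (A * x + B) * (C + x * E)
  distribute = solve-∀ ℚ-ring

evalVec-shift : ∀ {n} (cs : Vec ℤ (suc n)) x → evalVec (shift cs) x ≡ evalVec cs (x + 1ℚ)
evalVec-shift (c ∷ []) x = cong (ℤ→ℚ c +_) (trans (ℚ.*-zeroʳ x) (sym (ℚ.*-zeroʳ (x + 1ℚ))))
evalVec-shift (c ∷ cs@(_ ∷ _)) x = begin
  evalVec (addHead c (mulLinear 1ℤ 1ℤ (shift cs))) x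
    ≡⟨ evalVec-addHead c (mulLinear 1ℤ 1ℤ (shift cs)) x ⟩
  ℤ→ℚ c + evalVec (mulLinear 1ℤ 1ℤ (shift cs)) x
    ≡⟨ cong (ℤ→ℚ c +_) (evalVec-mulLinear 1ℤ 1ℤ (shift cs) x) ⟩
  ℤ→ℚ c + (1ℚ * x + 1ℚ) * evalVec (shift cs) x
    ≡⟨ cong₂ (λ u v → ℤ→ℚ c + (u + 1ℚ) * v) (ℚ.*-identityˡ x) (evalVec-shift cs x) ⟩
  ℤ→ℚ c + (x + 1ℚ) * evalVec cs (x + 1ℚ)
    ∎
  where open ≡-Reasoning

evalVec-zipWith-+ : ∀ {n} (cs ds : Vec ℤ n) x →
  evalVec (zipWith ℤ._+_ cs ds) x ≡ evalVec cs x + evalVec ds x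
evalVec-zipWith-+ [] [] x = sym (ℚ.+-identityʳ 0ℚ)
evalVec-zipWith-+ (c ∷ cs) (d ∷ ds) x = begin
  ℤ→ℚ (c ℤ.+ d) + x * evalVec (zipWith ℤ._+_ cs ds) x
    ≡⟨ cong₂ (λ u v → u + x * v) (ℤ→ℚ-+ c d) (evalVec-zipWith-+ cs ds x) ⟩
  ℤ→ℚ c + ℤ→ℚ d + x * (evalVec cs x + evalVec ds x)
    ≡⟨ regroup (ℤ→ℚ c) (ℤ→ℚ d) x (evalVec cs x) (evalVec ds x) ⟩
  ℤ→ℚ c + x * evalVec cs x + (ℤ→ℚ d + x * evalVec ds x)
    ∎
  where
  open ≡-Reasoning
  regroup : ∀ C D x E F → C + D + x * (E + F) ≡ C + x * E + (D + x * F)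
  regroup = solve-∀ ℚ-ring

last-addHead : ∀ {n} c (cs : Vec ℤ (suc (suc n))) → last (addHead c cs) ≡ last cs
last-addHead c (a ∷ as) = refl

last-mulLinear : ∀ {n} a b (cs : Vec ℤ (suc n)) → last (mulLinear a b cs) ≡ a ℤ.* last cs
last-mulLinear a b (c ∷ [])          = refl
last-mulLinear a b (c ∷ cs@(_ ∷ _)) =
  trans (last-addHead (a ℤ.* c) (mulLinear a b cs)) (last-mulLinear a b cs)

last-shift : ∀ {n} (cs : Vec ℤ (suc n)) → last (shift cs) ≡ last cs
last-shift (c ∷ [])          = refl
last-shift (c ∷ cs@(_ ∷ _)) = begin
  last (addHead c (mulLinear 1ℤ 1ℤ (shift cs))) ≡⟨ last-addHead c (mulLinear 1ℤ 1ℤ (shift cs)) ⟩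
  last (mulLinear 1ℤ 1ℤ (shift cs))             ≡⟨ last-mulLinear 1ℤ 1ℤ (shift cs) ⟩
  1ℤ ℤ.* last (shift cs)                        ≡⟨ ℤ.*-identityˡ (last (shift cs)) ⟩
  last (shift cs)                               ≡⟨ last-shift cs ⟩
  last cs                                       ∎
  where open ≡-Reasoning

last-zipWith : ∀ {A B C : Set} {n} (f : A → B → C) (as : Vec A (suc n)) (bs : Vec B (suc n)) →
  last (zipWith f as bs) ≡ f (last as) (last bs)
last-zipWith f (a ∷ [])          (b ∷ [])          = refl
last-zipWith f (a ∷ as@(_ ∷ _)) (b ∷ bs@(_ ∷ _)) = last-zipWith f as bs

-- f is an integer polynomial of degree exactly d; the leading coefficient is kept
-- positive so that sums of such polynomials keep their degree.
record IntPoly (d : ℕ) (f : ℚ → ℚ) : Set where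
  field
    coeffs      : Vec ℤ (suc d)
    lead        : ℕ
    last-coeffs : last coeffs ≡ +[1+ lead ]
    eval-coeffs : ∀ x → f x ≡ evalVec coeffs x

open IntPoly

intPoly-one : IntPoly 0 (λ _ → 1ℚ)
intPoly-one = record
  { coeffs      = 1ℤ ∷ []
  ; lead        = 0
  ; last-coeffs = refl
  ; eval-coeffs = λ x → sym (trans (cong (1ℚ +_) (ℚ.*-zeroʳ x)) (ℚ.+-identityʳ 1ℚ))
  }

intPoly-cong : ∀ {d f g} → (∀ x → f x ≡ g x) → IntPoly d f → IntPoly d g
intPoly-cong f≗g p = record
  { coeffs      = coeffs p
  ; lead        = lead p
  ; last-coeffs = last-coeffs p
  ; eval-coeffs = λ x → trans (sym (f≗g x)) (eval-coeffs p x)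
  }

intPoly-+ : ∀ {d f g} → IntPoly d f → IntPoly d g → IntPoly d (λ x → f x + g x)
intPoly-+ p q = record
  { coeffs      = zipWith ℤ._+_ (coeffs p) (coeffs q)
  ; lead        = _
  ; last-coeffs = trans (last-zipWith ℤ._+_ (coeffs p) (coeffs q))
                        (cong₂ ℤ._+_ (last-coeffs p) (last-coeffs q))
  ; eval-coeffs = λ x → trans (cong₂ _+_ (eval-coeffs p x) (eval-coeffs q x))
                              (sym (evalVec-zipWith-+ (coeffs p) (coeffs q) x))
  }

intPoly-*-linear : ∀ {d f} a b → IntPoly d f →
  IntPoly (suc d) (λ x → (ℕ→ℚ (suc a) * x + ℕ→ℚ b) * f x)
intPoly-*-linear a b p = record
  { coeffs      = mulLinear +[1+ a ] (ℤ.+ b) (coeffs p)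
  ; lead        = _
  ; last-coeffs = trans (last-mulLinear +[1+ a ] (ℤ.+ b) (coeffs p)) (cong (+[1+ a ] ℤ.*_) (last-coeffs p))
  ; eval-coeffs = λ x → trans (cong ((ℕ→ℚ (suc a) * x + ℕ→ℚ b) *_) (eval-coeffs p x))
                              (sym (evalVec-mulLinear +[1+ a ] (ℤ.+ b) (coeffs p) x))
  }

intPoly-*-monic : ∀ {d f} b → IntPoly d f → IntPoly (suc d) (λ x → (x + ℕ→ℚ b) * f x)
intPoly-*-monic {f = f} b p =
  intPoly-cong (λ x → cong (λ u → (u + ℕ→ℚ b) * f x) (ℚ.*-identityˡ x)) (intPoly-*-linear 0 b p)

intPoly-shift : ∀ {d f} → IntPoly d f → IntPoly d (λ x → f (x + 1ℚ))
intPoly-shift p = record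
  { coeffs      = shift (coeffs p)
  ; lead        = lead p
  ; last-coeffs = trans (last-shift (coeffs p)) (last-coeffs p)
  ; eval-coeffs = λ x → trans (eval-coeffs p (x + 1ℚ)) (sym (evalVec-shift (coeffs p) x))
  }

intPoly-coefficients : ∀ {d f} → IntPoly d f →
  Σ (List ℤ) λ ds → Σ ℤ λ c → c ≢ 0ℤ × length ds ≡ d × (∀ x → f x ≡ evalPoly (ds ++ c ∷ []) x)
intPoly-coefficients p =
  toList (init (coeffs p)) , last (coeffs p) , lead≢0 , length-toList (init (coeffs p)) ,
  λ x → trans (eval-coeffs p x) (cong (λ cs → evalPoly cs x) init++last)
  where
  lead≢0 : last (coeffs p) ≢ 0ℤ
  lead≢0 rewrite last-coeffs p = λ ()
  init++last : toList (coeffs p) ≡ toList (init (coeffs p)) ++ last (coeffs p) ∷ []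
  init++last = trans (cong toList (proj₂ (proj₂ (initLast (coeffs p)))))
                     (toList-∷ʳ (last (coeffs p)) (init (coeffs p)))

intPoly-prodShift : ∀ k → IntPoly k (prodShift k)
intPoly-prodShift zero    = intPoly-one
intPoly-prodShift (suc k) =
  intPoly-cong (λ x → ℚ.*-comm (x + ℕ→ℚ (suc k)) (prodShift k x))
               (intPoly-*-monic (suc k) (intPoly-prodShift k))

prodShift-suc : ∀ k x → prodShift (suc k) x ≡ (x + 1ℚ) * prodShift k (x + 1ℚ)
prodShift-suc zero    x = ℚ.*-comm 1ℚ (x + ℕ→ℚ 1)
prodShift-suc (suc k) x = begin
  prodShift (suc k) x * (x + ℕ→ℚ (suc (suc k)))
    ≡⟨ cong₂ _*_ (prodShift-suc k x) (cong (x +_) (ℕ→ℚ-suc (suc k))) ⟩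
  (x + 1ℚ) * prodShift k (x + 1ℚ) * (x + (ℕ→ℚ (suc k) + 1ℚ))
    ≡⟨ regroup x (ℕ→ℚ (suc k)) (prodShift k (x + 1ℚ)) ⟩
  (x + 1ℚ) * (prodShift k (x + 1ℚ) * (x + 1ℚ + ℕ→ℚ (suc k)))
    ∎
  where
  open ≡-Reasoning
  regroup : ∀ x J L → (x + 1ℚ) * L * (x + (J + 1ℚ)) ≡ (x + 1ℚ) * (L * (x + 1ℚ + J))
  regroup = solve-∀ ℚ-ring

isOdd-n*2 : ∀ n → isOdd (n ℕ.* 2) ≡ false
isOdd-n*2 zero    = refl
isOdd-n*2 (suc n) rewrite isOdd-n*2 n = refl

⌊n*2/2⌋≡n : ∀ n → ⌊ n ℕ.* 2 /2⌋ ≡ n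
⌊n*2/2⌋≡n zero    = refl
⌊n*2/2⌋≡n (suc n) = cong suc (⌊n*2/2⌋≡n n)

⌊1+n*2/2⌋≡n : ∀ n → ⌊ 1 ℕ.+ n ℕ.* 2 /2⌋ ≡ n
⌊1+n*2/2⌋≡n zero    = refl
⌊1+n*2/2⌋≡n (suc n) = cong suc (⌊1+n*2/2⌋≡n n)

ℓ-odd : ∀ k x → ℓ (1 ℕ.+ k ℕ.* 2) x ≡ prodShift k x
ℓ-odd k x = cong (λ j → prodShift j x) (⌊n*2/2⌋≡n k)

even-or-odd : ∀ n → (∃[ k ] n ≡ k ℕ.* 2) ⊎ (∃[ k ] n ≡ 1 ℕ.+ k ℕ.* 2)
even-or-odd zero    = inj₁ (0 , refl)
even-or-odd (suc n) with even-or-odd n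
... | inj₁ (k , refl) = inj₂ (k , refl)
... | inj₂ (k , refl) = inj₁ (suc k , refl)

divℚ-unique : ∀ {p q r} → q ≢ 0ℚ → r * q ≡ p → divℚ p q ≡ r
divℚ-unique {p} {q} {r} q≢0 r*q≡p with q ≟ 0ℚ
... | yes q≡0 = ⊥-elim (q≢0 q≡0)
... | no q≢0′ = begin
  p * ℚ.1/ q        ≡⟨ cong (_* ℚ.1/ q) r*q≡p ⟨
  r * q * ℚ.1/ q    ≡⟨ ℚ.*-assoc r q (ℚ.1/ q) ⟩
  r * (q * ℚ.1/ q)  ≡⟨ cong (r *_) (ℚ.*-inverseʳ q) ⟩
  r * 1ℚ            ≡⟨ ℚ.*-identityʳ r ⟩
  r                 ∎
  where
  open ≡-Reasoning
  instance _ = ℚ.≢-nonZero q≢0′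

P-recurrence-even : ∀ m x {a b r} → isOdd m ≡ false →
  P (2 ℕ.+ m) x ≡ a → P (2 ℕ.+ m) (x + 1ℚ) ≡ b →
  r * ℕ→ℚ 4 ≡ ℕ→ℚ 4 * (x + ℕ→ℚ (2 ℕ.+ m)) * a + ℕ→ℚ 2 * (ℕ→ℚ 2 * x + ℕ→ℚ (3 ℕ.+ m)) * b
              + (ℕ→ℚ 4 * x + ℕ→ℚ (2 ℕ.+ m)) * ℓ (1 ℕ.+ m) x →
  P (3 ℕ.+ m) x ≡ r
P-recurrence-even m x even refl refl eq rewrite even = divℚ-unique (λ ()) eq

P-recurrence-odd : ∀ m x {a b r} → isOdd m ≡ true →
  P (2 ℕ.+ m) x ≡ a → P (2 ℕ.+ m) (x + 1ℚ) ≡ b →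
  ℕ→ℚ 4 * (ℕ→ℚ 2 * x + ℕ→ℚ (2 ℕ.+ m)) ≢ 0ℚ →
  r * (ℕ→ℚ 4 * (ℕ→ℚ 2 * x + ℕ→ℚ (2 ℕ.+ m)))
    ≡ ℕ→ℚ 2 * (x + ℕ→ℚ (2 ℕ.+ m)) * a + (ℕ→ℚ 2 * x + ℕ→ℚ (2 ℕ.+ m)) * b
      + (ℕ→ℚ 4 * x + ℕ→ℚ (2 ℕ.+ m)) * ℓ (2 ℕ.+ m) x →
  P (3 ℕ.+ m) x ≡ r
P-recurrence-odd m x odd refl refl ≢0 eq rewrite odd = divℚ-unique ≢0 eq

4[2x+1+m]≢0 : ∀ {x} → 0ℚ ≤ x → ∀ m → ℕ→ℚ 4 * (ℕ→ℚ 2 * x + ℕ→ℚ (suc m)) ≢ 0ℚ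
4[2x+1+m]≢0 {x} 0≤x m =
  ≢-sym (ℚ.<⇒≢ (ℚ.positive⁻¹ (ℕ→ℚ 4 * (ℕ→ℚ 2 * x + ℕ→ℚ (suc m))) {{positive}}))
  where
  instance
    _ = ℚ.nonNegative 0≤x
    _ = ℚ.normalize-pos (suc m) 1
    _ = ℚ.normalize-pos 4 1
    _ = ℚ.nonNeg*nonNeg⇒nonNeg (ℕ→ℚ 2) {{ℚ.normalize-nonNeg 2 1}} x
    _ = ℚ.nonNeg+pos⇒pos (ℕ→ℚ 2 * x) (ℕ→ℚ (suc m))
  positive : ℚ.Positive (ℕ→ℚ 4 * (ℕ→ℚ 2 * x + ℕ→ℚ (suc m)))
  positive = ℚ.pos*pos⇒pos (ℕ→ℚ 4) (ℕ→ℚ 2 * x + ℕ→ℚ (suc m))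

0≤x+1 : ∀ {x} → 0ℚ ≤ x → 0ℚ ≤ x + 1ℚ
0≤x+1 {x} 0≤x = ℚ.nonNegative⁻¹ _ {{ℚ.nonNeg+nonNeg⇒nonNeg x {{ℚ.nonNegative 0≤x}} 1ℚ}}

Peven : ℕ → ℚ → ℚ
Peven zero    x = 1ℚ
Peven (suc k) x = (x + ℕ→ℚ (3 ℕ.+ k ℕ.* 2)) * Peven k (x + 1ℚ) + prodShift (suc k) x

Podd : ℕ → ℚ → ℚ
Podd k x = prodShift (suc k) x + (ℕ→ℚ 2 * x + ℕ→ℚ (3 ℕ.+ k ℕ.* 2)) * Peven k (x + 1ℚ)

intPoly-Peven : ∀ k → IntPoly k (Peven k)
intPoly-Peven zero    = intPoly-one
intPoly-Peven (suc k) =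
  intPoly-+ (intPoly-*-monic (3 ℕ.+ k ℕ.* 2) (intPoly-shift (intPoly-Peven k)))
            (intPoly-prodShift (suc k))

intPoly-Podd : ∀ k → IntPoly (suc k) (Podd k)
intPoly-Podd k =
  intPoly-+ (intPoly-prodShift (suc k))
            (intPoly-*-linear 1 (3 ℕ.+ k ℕ.* 2) (intPoly-shift (intPoly-Peven k)))

-- The index-dependent constants enter as variables tied to J = k + 1 by equations;
-- once these are matched with refl, each goal is a polynomial identity modulo the
-- invariant, which the ring solver proves after a multiple of the invariant is added.
odd-step-identity : ∀ x J {N n E₀ E₁ L₀ Λ} → N ≡ J + J → n ≡ N + 1ℚ → Λ ≡ L₀ →
  (ℕ→ℚ 2 * x + n) * E₁ + J * L₀ ≡ ℕ→ℚ 2 * (x + N) * E₀ →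
  (L₀ * (x + J) + (ℕ→ℚ 2 * x + n) * E₁) * ℕ→ℚ 4
    ≡ ℕ→ℚ 4 * (x + N) * E₀ + ℕ→ℚ 2 * (ℕ→ℚ 2 * x + n) * E₁ + (ℕ→ℚ 4 * x + N) * Λ
odd-step-identity x J {E₀ = E₀} {E₁} {L₀} refl refl refl invariant =
  cancel-multiple (ℕ→ℚ 2) invariant (solve (List ℚ ∋ x ∷ J ∷ E₀ ∷ E₁ ∷ L₀ ∷ []) ℚ-ring)

even-step-identity : ∀ x J {N n E₁ E₂ L₁ Π Λ} →
  N ≡ J + J → n ≡ N + 1ℚ → Π ≡ (x + 1ℚ) * L₁ → Λ ≡ Π →
  (ℕ→ℚ 2 * (x + 1ℚ) + n) * E₂ + J * L₁ ≡ ℕ→ℚ 2 * (x + 1ℚ + N) * E₁ →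
  ((x + n) * E₁ + Π) * (ℕ→ℚ 4 * (ℕ→ℚ 2 * x + n))
    ≡ ℕ→ℚ 2 * (x + n) * (Π + (ℕ→ℚ 2 * x + n) * E₁)
      + (ℕ→ℚ 2 * x + n) * (L₁ * (x + 1ℚ + J) + (ℕ→ℚ 2 * (x + 1ℚ) + n) * E₂)
      + (ℕ→ℚ 4 * x + n) * Λ
even-step-identity x J {E₁ = E₁} {E₂} {L₁} refl refl refl refl invariant =
  cancel-multiple (ℕ→ℚ 2 * x + (J + J + 1ℚ)) (sym invariant)
    (solve (List ℚ ∋ x ∷ J ∷ E₁ ∷ E₂ ∷ L₁ ∷ []) ℚ-ring)

invariant-step : ∀ y J {N n n₄ n₅ J′ E₁ E₂ L₁ Π} →
  N ≡ J + J → n ≡ N + 1ℚ → n₄ ≡ n + 1ℚ → n₅ ≡ n₄ + 1ℚ → J′ ≡ J + 1ℚ → Π ≡ (y + 1ℚ) * L₁ →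
  (ℕ→ℚ 2 * (y + 1ℚ) + n) * E₂ + J * L₁ ≡ ℕ→ℚ 2 * (y + 1ℚ + N) * E₁ →
  (ℕ→ℚ 2 * y + n₅) * ((y + 1ℚ + n) * E₂ + L₁ * (y + 1ℚ + J)) + J′ * Π
    ≡ ℕ→ℚ 2 * (y + n₄) * ((y + n) * E₁ + Π)
invariant-step y J {E₁ = E₁} {E₂} {L₁} refl refl refl refl refl refl invariant =
  cancel-multiple (y + (J + J + 1ℚ + 1ℚ)) invariant
    (solve (List ℚ ∋ y ∷ J ∷ E₁ ∷ E₂ ∷ L₁ ∷ []) ℚ-ring)

Peven-invariant : ∀ k y →
  (ℕ→ℚ 2 * y + ℕ→ℚ (3 ℕ.+ k ℕ.* 2)) * Peven k (y + 1ℚ) + ℕ→ℚ (suc k) * prodShift k y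
    ≡ ℕ→ℚ 2 * (y + ℕ→ℚ (2 ℕ.+ k ℕ.* 2)) * Peven k y
Peven-invariant zero    y = base y
  where
  base : ∀ y → (ℕ→ℚ 2 * y + ℕ→ℚ 3) * 1ℚ + ℕ→ℚ 1 * 1ℚ ≡ ℕ→ℚ 2 * (y + ℕ→ℚ 2) * 1ℚ
  base = solve-∀ ℚ-ring
Peven-invariant (suc k) y =
  invariant-step y (ℕ→ℚ (suc k))
    (ℕ→ℚ-double (suc k)) (ℕ→ℚ-suc (2 ℕ.+ k ℕ.* 2)) (ℕ→ℚ-suc (3 ℕ.+ k ℕ.* 2))
    (ℕ→ℚ-suc (4 ℕ.+ k ℕ.* 2)) (ℕ→ℚ-suc (suc k)) (prodShift-suc k y)
    (Peven-invariant k (y + 1ℚ))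

P≡Podd-step : ∀ k → (∀ x → 0ℚ ≤ x → P (2 ℕ.+ k ℕ.* 2) x ≡ Peven k x) →
             ∀ x → 0ℚ ≤ x → P (3 ℕ.+ k ℕ.* 2) x ≡ Podd k x
P≡Podd-step k P≡Peven x 0≤x =
  P-recurrence-even (k ℕ.* 2) x (isOdd-n*2 k) (P≡Peven x 0≤x) (P≡Peven (x + 1ℚ) (0≤x+1 0≤x))
    (odd-step-identity x (ℕ→ℚ (suc k))
      (ℕ→ℚ-double (suc k)) (ℕ→ℚ-suc (2 ℕ.+ k ℕ.* 2)) (ℓ-odd k x)
      (Peven-invariant k x))

P≡Peven-step : ∀ k → (∀ x → 0ℚ ≤ x → P (3 ℕ.+ k ℕ.* 2) x ≡ Podd k x) →
              ∀ x → 0ℚ ≤ x → P (4 ℕ.+ k ℕ.* 2) x ≡ Peven (suc k) x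
P≡Peven-step k P≡Podd x 0≤x =
  P-recurrence-odd (1 ℕ.+ k ℕ.* 2) x (cong not (isOdd-n*2 k))
    (P≡Podd x 0≤x) (P≡Podd (x + 1ℚ) (0≤x+1 0≤x)) (4[2x+1+m]≢0 0≤x (2 ℕ.+ k ℕ.* 2))
    (even-step-identity x (ℕ→ℚ (suc k))
      (ℕ→ℚ-double (suc k)) (ℕ→ℚ-suc (2 ℕ.+ k ℕ.* 2)) (prodShift-suc k x) (ℓ-odd (suc k) x)
      (Peven-invariant k (x + 1ℚ)))

P≡Peven : ∀ k x → 0ℚ ≤ x → P (2 ℕ.+ k ℕ.* 2) x ≡ Peven k x
P≡Peven zero    x _ = refl
P≡Peven (suc k)     = P≡Peven-step k (P≡Podd-step k (P≡Peven k))

P≡Podd : ∀ k x → 0ℚ ≤ x → P (3 ℕ.+ k ℕ.* 2) x ≡ Podd k x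
P≡Podd k = P≡Podd-step k (P≡Peven k)

P-coefficients : ∀ n {d f} → IntPoly d f → d ≡ ⌊ n ∸ 1 /2⌋ → (∀ x → 0ℚ ≤ x → P n x ≡ f x) →
  Σ (List ℤ) λ ds → Σ ℤ λ c →
    c ≢ 0ℤ × length ds ≡ ⌊ n ∸ 1 /2⌋ × ((x : ℚ) → 0ℚ ≤ x → P n x ≡ evalPoly (ds ++ c ∷ []) x)
P-coefficients n p refl P≡f with intPoly-coefficients p
... | ds , c , c≢0 , length≡ , f≡ =
  ds , c , c≢0 , length≡ , λ x 0≤x → trans (P≡f x 0≤x) (f≡ x)

theorem2 : (n : ℕ) → n ≥ 1 →
    Σ (List ℤ) λ ds → Σ ℤ λ c →
    c ≢ 0ℤ × length ds ≡ ⌊ n ∸ 1 /2⌋ ×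
    ((x : ℚ) → 0ℚ ≤ x → P n x ≡ evalPoly (ds ++ c ∷ []) x)
theorem2 n n≥1 with even-or-odd n | n≥1
... | inj₁ (zero  , refl) | ()
... | inj₁ (suc k , refl) | _ =
  P-coefficients n (intPoly-Peven k) (sym (⌊1+n*2/2⌋≡n k)) (P≡Peven k)
... | inj₂ (zero  , refl) | _ =
  P-coefficients n intPoly-one refl (λ _ _ → refl)
... | inj₂ (suc k , refl) | _ =
  P-coefficients n (intPoly-Podd k) (sym (cong suc (⌊n*2/2⌋≡n k))) (P≡Podd k)
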